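{- Let $F$ be a Morse stack on a normal $d$-pseudomanifold $M$, and let $x$ be a facet of $M$. Let $\tilde\pi$ be a $\tilde\Lambda_d$-path in $F$ from $x$ to a face $y\in M$. Then exactly one of the following holds: (1) $\{y\}$ is a minimum of $F$; (2) there exists a unique face of $M$ that is an extension of $\tilde\pi$.
   Context: A simplex is a non-empty finite set; its dimension is its cardinality minus one. A complex is a finite set $X$ of simplexes closed under taking non-empty subsets; elements are faces, facets are faces maximal for inclusion. A path in a set of simplexes is a sequence of its elements in which consecutive elements are comparable for inclusion; connected components are defined via such paths. A covering pair (or $p$-pair) of $X$ is a pair $(x,y)$ of faces with $x\subseteq y$, $\dim y=p$, $\dim x=p-1$. A strong $d$-path is a path in which each two consecutive elements form a $d$-pair in one order or the other. A subset $S\subseteq X$ is open if it is closed under taking supersets within $X$. A normal $d$-pseudomanifold ($d\ge1$) is a connected complex $M$ whose facets all have dimension $d$, in which each $(d-1)$-face lies in exactly two $d$-faces, and in which every connected open subset $S$ is strongly connected (any two facets of $S$ are joined by a strong $d$-path in $S$). A stack on $X$ is a map $F:X\to\mathbb Z$ with $F(x)\ge F(y)$ whenever $x\subseteq y$; $F[\lambda]=\{x:F(x)\ge\lambda\}$; a minimum of $F$ (at altitude $\lambda$) is a connected component $A$ of $X\setminus F[\lambda+1]$ with $A\cap(X\setminus F[\lambda])=\emptyset$. A flat pair is a covering pair $(x,y)$ with $F(x)=F(y)$; $F$ is a Morse stack if each face is in at most one flat pair. If $(x,y)$ is a covering pair with $F(x)>F(y)$, then $(y,x)$ is a differential pair.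 $\mathrm{grad}_p(F)$ is the set of flat pairs $(x,y)$ with $\dim y=p$; $\mathrm{diff}_p(F)$ is the set of differential pairs $(y,x)$ with $\dim y=p$. A $\Lambda_p$-path in $F$ from $x_0$ to $x_k$ is a sequence $\langle x_0,\dots,x_k\rangle$ of faces such that each $(x_i,x_{i+1})$ lies in $\mathrm{grad}_p(F)\cup\mathrm{diff}_p(F)$. A $\tilde\Lambda_p$-path from $a$ to $b$ is the reversal of a $\Lambda_p$-path from $b$ to $a$. A face $z$ is an extension of a $\tilde\Lambda_p$-path $\langle s_0,\dots,s_k\rangle$ if $\langle s_0,\dots,s_k,z\rangle$ is a $\tilde\Lambda_p$-path. -}

module Defs where

open import Data.Bool using (Bool; T)
open import Data.Nat using (ℕ; suc; _≥_)
open import Data.Integer using (ℤ; _≤_; _<_; _+_; 1ℤ)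
open import Data.Fin.Subset using (Subset; _⊆_; ∣_∣; Nonempty)
open import Data.List using (List; _∷_; []; head; last)
open import Data.List.Relation.Unary.All using (All)
open import Data.List.Relation.Unary.Linked using (Linked)
open import Data.Maybe using (just)
open import Data.Product using (Σ; ∃; _×_; _,_)
open import Data.Sum using (_⊎_)
open import Relation.Nullary using (¬_)
open import Relation.Binary.PropositionalEquality using (_≡_; _≢_)

-- Vertices are the elements of Fin n; a simplex is a (non-empty) subset of Fin n.
-- A "set of simplexes" is a predicate on Subset n.

module _ {n : ℕ} where

  Simplex : Set
  Simplex = Subset n

  SetOf : Set₁
  SetOf = Simplex → Set

  -- dim s = p  (dim = cardinality - 1)
  HasDim : ℕ → Simplex → Set
  HasDim p s = ∣ s ∣ ≡ suc p

  -- A complex: a (finite, since Subset n is finite) set of simplexes, given by a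
  -- Boolean membership function, closed under taking non-empty subsets.
  record Complex : Set where
    field
      face      : Simplex → Bool
      nonempty  : ∀ s → T (face s) → Nonempty s
      down-closed : ∀ s t → T (face s) → t ⊆ s → Nonempty t → T (face t)
  open Complex public

  Face : Complex → SetOf
  Face X s = T (face X s)

  Facet : Complex → SetOf
  Facet X s = Face X s × (∀ t → Face X t → s ⊆ t → t ≡ s)

  Comparable : Simplex → Simplex → Set
  Comparable a b = a ⊆ b ⊎ b ⊆ a

  PathIn : SetOf → Simplex → Simplex → List Simplex → Set
  PathIn S a b xs = head xs ≡ just a × last xs ≡ just b × All S xs × Linked Comparable xs

  Connected : SetOf → Set
  Connected S = ∀ a b → S a → S b → ∃ λ xs → PathIn S a b xs

  ConnectedComponent : SetOf → SetOf → Set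
  ConnectedComponent A T =
    (∀ s → A s → T s) × (∃ λ s → A s) × Connected A ×
    (∀ a b → A a → T b → Comparable a b → A b)

  CoveringPair : Complex → ℕ → Simplex → Simplex → Set
  CoveringPair X p x y = Face X x × Face X y × x ⊆ y × HasDim p y × ∣ x ∣ ≡ p

  StrongPathIn : Complex → ℕ → SetOf → Simplex → Simplex → List Simplex → Set
  StrongPathIn X d S a b xs =
    head xs ≡ just a × last xs ≡ just b × All S xs ×
    Linked (λ u v → CoveringPair X d u v ⊎ CoveringPair X d v u) xs

  Open : Complex → SetOf → Set
  Open X S = (∀ s → S s → Face X s) × (∀ s t → S s → Face X t → s ⊆ t → S t)

  FacetOf : SetOf → SetOf
  FacetOf S s = S s × (∀ t → S t → s ⊆ t → t ≡ s)

  StronglyConnected : Complex → ℕ → SetOf → Set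
  StronglyConnected X d S =
    ∀ a b → FacetOf S a → FacetOf S b → ∃ λ xs → StrongPathIn X d S a b xs

  record NormalPseudomanifold (d : ℕ) (M : Complex) : Set₁ where
    field
      d≥1        : d ≥ 1
      connected  : Connected (Face M)
      pure       : ∀ s → Facet M s → HasDim d s
      thin       : ∀ f → Face M f → ∣ f ∣ ≡ d →
                   Σ Simplex λ a → Σ Simplex λ b →
                     a ≢ b × Face M a × HasDim d a × f ⊆ a ×
                     Face M b × HasDim d b × f ⊆ b ×
                     (∀ c → Face M c → HasDim d c → f ⊆ c → c ≡ a ⊎ c ≡ b)
      normal     : ∀ (S : SetOf) → Open M S → Connected S → StronglyConnected M d S

  Stack : Complex → (Simplex → ℤ) → Set
  Stack X F = ∀ x y → Face X x → Face X y → x ⊆ y → F y ≤ F x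

  Level : Complex → (Simplex → ℤ) → ℤ → SetOf
  Level X F λ' s = Face X s × λ' ≤ F s

  Below : Complex → (Simplex → ℤ) → ℤ → SetOf
  Below X F λ' s = Face X s × ¬ (λ' + 1ℤ ≤ F s)

  MinimumAt : Complex → (Simplex → ℤ) → ℤ → SetOf → Set
  MinimumAt X F λ' A =
    ConnectedComponent A (Below X F λ') ×
    (∀ s → A s → ¬ (Face X s × ¬ (λ' ≤ F s)))

  Minimum : Complex → (Simplex → ℤ) → SetOf → Set
  Minimum X F A = ∃ λ λ' → MinimumAt X F λ' A

  FlatPair : Complex → (Simplex → ℤ) → Simplex → Simplex → Set
  FlatPair X F x y = Σ ℕ λ p → CoveringPair X p x y × F x ≡ F y

  InPair : Simplex → Simplex → Simplex → Set
  InPair z x y = z ≡ x ⊎ z ≡ y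

  MorseStack : Complex → (Simplex → ℤ) → Set
  MorseStack X F =
    Stack X F ×
    (∀ z x y x' y' → FlatPair X F x y → FlatPair X F x' y' →
       InPair z x y → InPair z x' y' → x ≡ x' × y ≡ y')

  Grad : Complex → (Simplex → ℤ) → ℕ → Simplex → Simplex → Set
  Grad X F p x y = CoveringPair X p x y × F x ≡ F y

  Diff : Complex → (Simplex → ℤ) → ℕ → Simplex → Simplex → Set
  Diff X F p y x = CoveringPair X p x y × F y < F x

  LambdaStep : Complex → (Simplex → ℤ) → ℕ → Simplex → Simplex → Set
  LambdaStep X F p a b = Grad X F p a b ⊎ Diff X F p a b

  LambdaPath : Complex → (Simplex → ℤ) → ℕ → Simplex → Simplex → List Simplex → Set
  LambdaPath X F p a b xs =
    head xs ≡ just a × last xs ≡ just b × All (Face X) xs × Linked (LambdaStep X F p) xs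

  -- Λ̃_p-path from a to b: reversal of a Λ_p-path from b to a
  -- (consecutive (s_i , s_{i+1}) with (s_{i+1} , s_i) ∈ grad_p ∪ diff_p)
  LambdaTildePath : Complex → (Simplex → ℤ) → ℕ → Simplex → Simplex → List Simplex → Set
  LambdaTildePath X F p a b xs =
    head xs ≡ just a × last xs ≡ just b × All (Face X) xs ×
    Linked (λ u v → LambdaStep X F p v u) xs

  Extension : Complex → (Simplex → ℤ) → ℕ → List Simplex → Simplex → Set
  Extension X F p xs z =
    Σ Simplex λ a → LambdaTildePath X F p a z (xs Data.List.++ (z ∷ []))

-- The last face y of a Λ̃_d-path from a facet is either a d-face, or a (d-1)-face entered
-- from a d-face u with (y , u) flat; the extensions of the path are exactly the faces z
-- with (z , y) ∈ grad_d ∪ diff_d.  If y is a d-face (a facet, by purity), its extensions are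
-- its flat (d-1)-faces, of which the Morse property allows at most one; if there is none,
-- any face b ⊊ y lies in a (d-1)-face t of y with F y ≤ F t ≤ F b, so F b ≤ F y would make
-- (t , y) flat: hence {y} is a component of the sublevel set at F y, i.e. a minimum.
-- If y is a (d-1)-face, thinness gives exactly one other d-coface w; since (y , u) is
-- already flat, F w < F y and w is the unique extension.  Whenever an extension exists,
-- the flat partner of y is a comparable face with the same value, so {y} is no minimum.

module Submission where

open import Defs
open import Data.Nat using (ℕ)
open import Data.Integer using (ℤ)
open import Data.Fin.Subset using (Subset)
open import Data.List using (List)
open import Data.Product using (Σ; _×_)
open import Data.Sum using (_⊎_)
open import Relation.Nullary using (¬_)
open import Relation.Binary.PropositionalEquality using (_≡_)

open import Data.Empty using (⊥-elim)
open import Data.Fin using (Fin)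
open import Data.Fin.Subset using (_⊆_; _⊂_; _⊃_; _∈_; ∣_∣; _-_; ⁅_⁆; inside; outside)
open import Data.Fin.Subset.Induction using (Acc; acc; ⊃-wellFounded)
open import Data.Fin.Subset.Properties
  using ( _∈?_; _⊆?_; _⊂?_; ⊆-antisym; ⊆-trans; anySubset?
        ; p⊂q⇒p⊆q; p⊂q⇒∣p∣<∣q∣; p─⊥≡p; p─q⊆p; x∈p∧x≢y⇒x∈p-y)
open import Data.Integer using (_≤_; _<_; _+_; 1ℤ)
open import Data.List using ([]; _∷_; [_]; _∷ʳ_; head; last)
open import Data.List.Relation.Unary.All as All using (All; []; _∷_)
import Data.List.Relation.Unary.All.Properties as All
open import Data.List.Relation.Unary.Linked as Linked using (Linked; []; [-]; _∷_)
import Data.List.Relation.Unary.Linked.Properties as Linked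
open import Data.Maybe using (just)
import Data.Maybe.Relation.Binary.Connected as Maybe
open import Data.Product using (∃; ∃!; _,_; proj₁; proj₂)
open import Data.Sum using (inj₁; inj₂; swap; map₂)
open import Data.Vec using (_∷_; here; there)
open import Function using (_∘_; id; _⇔_; mk⇔; Equivalence)
open import Relation.Nullary using (Dec; yes; no; contradiction)
open import Relation.Nullary.Decidable using (T?; _×-dec_; decidable-stable)
open import Relation.Binary.PropositionalEquality using (_≢_; refl; sym; trans; cong; subst)
import Data.Nat as ℕ
import Data.Nat.Properties as ℕₚ
import Data.Integer.Properties as ℤₚ

⊆∧⊄⇒≡ : ∀ {n} {p q : Subset n} → p ⊆ q → ¬ (p ⊂ q) → p ≡ q
⊆∧⊄⇒≡ {p = p} {q} p⊆q p⊄q = ⊆-antisym p⊆q q⊆p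
  where
  q⊆p : q ⊆ p
  q⊆p {i} i∈q = decidable-stable (i ∈? p) (λ i∉p → p⊄q (p⊆q , i , i∈q , i∉p))

x∈p⇒1+∣p-x∣≡∣p∣ : ∀ {n} {p : Subset n} {x : Fin n} → x ∈ p → ℕ.suc ∣ p - x ∣ ≡ ∣ p ∣
x∈p⇒1+∣p-x∣≡∣p∣ {p = _ ∷ p} here = cong ℕ.suc (cong ∣_∣ (p─⊥≡p p))
x∈p⇒1+∣p-x∣≡∣p∣ {p = outside ∷ _} (there x∈p) = x∈p⇒1+∣p-x∣≡∣p∣ x∈p
x∈p⇒1+∣p-x∣≡∣p∣ {p = inside ∷ _} (there x∈p) = cong ℕ.suc (x∈p⇒1+∣p-x∣≡∣p∣ x∈p)

module _ {i j : ℤ} where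

  i+1≤j⇒i<j : i + 1ℤ ≤ j → i < j
  i+1≤j⇒i<j = ℤₚ.suc[i]≤j⇒i<j ∘ subst (_≤ j) (ℤₚ.+-comm i 1ℤ)

  i<j⇒i+1≤j : i < j → i + 1ℤ ≤ j
  i<j⇒i+1≤j = subst (_≤ j) (ℤₚ.+-comm 1ℤ i) ∘ ℤₚ.i<j⇒suc[i]≤j

last-∷ʳ : ∀ {A : Set} (xs : List A) z → last (xs ∷ʳ z) ≡ just z
last-∷ʳ [] z = refl
last-∷ʳ (_ ∷ []) z = refl
last-∷ʳ (_ ∷ b ∷ xs) z = last-∷ʳ (b ∷ xs) z

module _ {A : Set} {R : A → A → Set} where

  Linked-last : ∀ {a y xs} → head xs ≡ just a → last xs ≡ just y → Linked R xs →
                y ≡ a ⊎ ∃ λ u → R u y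
  Linked-last {xs = _ ∷ []} refl refl _ = inj₁ refl
  Linked-last {xs = a ∷ b ∷ xs} refl last≡y (Rab ∷ Rbxs) with Linked-last {xs = b ∷ xs} refl last≡y Rbxs
  ... | inj₁ refl = inj₂ (a , Rab)
  ... | inj₂ step = inj₂ step

  Linked-∷ʳ⁻ : ∀ {y z} xs → last xs ≡ just y → Linked R (xs ∷ʳ z) → R y z
  Linked-∷ʳ⁻ (_ ∷ []) refl (Ryz ∷ _) = Ryz
  Linked-∷ʳ⁻ (_ ∷ b ∷ xs) last≡y (_ ∷ Rxs) = Linked-∷ʳ⁻ (b ∷ xs) last≡y Rxs

  Linked-∷ʳ⁺ : ∀ {y z xs} → last xs ≡ just y → Linked R xs → R y z → Linked R (xs ∷ʳ z)
  Linked-∷ʳ⁺ {z = z} last≡y Rxs Ryz =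
    Linked.++⁺ Rxs (subst (λ m → Maybe.Connected R m (just z)) (sym last≡y) (Maybe.just Ryz)) [-]

ExactlyOne : Set → Set → Set
ExactlyOne A B = (A ⊎ B) × ¬ (A × B)

module _ {A B : Set} where

  only-left : A → ¬ B → ExactlyOne A B
  only-left a ¬b = inj₁ a , ¬b ∘ proj₂

  only-right : B → ¬ A → ExactlyOne A B
  only-right b ¬a = inj₂ b , ¬a ∘ proj₁

  ExactlyOne-mapʳ : ∀ {C} → B ⇔ C → ExactlyOne A B → ExactlyOne A C
  ExactlyOne-mapʳ B⇔C (a⊎b , ¬a×b) =
    map₂ (Equivalence.to B⇔C) a⊎b , λ (a , c) → ¬a×b (a , Equivalence.from B⇔C c)

module _ {n : ℕ} (M : Complex {n}) where

  facet-above : ∀ s → Face M s → ∃ λ t → Facet M t × s ⊆ t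
  facet-above s = go s (⊃-wellFounded s)
    where
    go : ∀ s → Acc _⊃_ s → Face M s → ∃ λ t → Facet M t × s ⊆ t
    go s (acc rec) fs with anySubset? (λ t → T? (face M t) ×-dec s ⊂? t)
    ... | yes (t , ft , s⊂t) with go t (rec s⊂t) ft
    ...   | u , facet-u , t⊆u = u , facet-u , ⊆-trans (p⊂q⇒p⊆q s⊂t) t⊆u
    go s _ fs | no ∄coface = s , (fs , maximal) , id
      where
      maximal : ∀ t → Face M t → s ⊆ t → t ≡ s
      maximal t ft s⊆t = sym (⊆∧⊄⇒≡ s⊆t (λ s⊂t → ∄coface (t , ft , s⊂t)))

  lower-face⇒¬HasDim : ∀ {p x y} → CoveringPair M p x y → ¬ HasDim p x
  lower-face⇒¬HasDim (_ , _ , _ , _ , ∣x∣≡p) dim-x = ℕₚ.1+n≢n (trans (sym dim-x) ∣x∣≡p)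

  pure-face⇒facet : ∀ {p} → (∀ s → Facet M s → HasDim p s) → ∀ y → Face M y → HasDim p y → Facet M y
  pure-face⇒facet pure y fy dim-y with facet-above y fy
  ... | t , facet-t , y⊆t = subst (Facet M) (sym y≡t) facet-t
    where
    y≡t : y ≡ t
    y≡t = ⊆∧⊄⇒≡ y⊆t λ y⊂t →
      ℕₚ.<-irrefl (trans dim-y (sym (pure t facet-t))) (p⊂q⇒∣p∣<∣q∣ y⊂t)

module Minima {n : ℕ} (M : Complex {n}) (F : Subset n → ℤ) where

  below⁺ : ∀ {λ' s} → Face M s → F s ≤ λ' → Below M F λ' s
  below⁺ fs Fs≤λ = fs , ℤₚ.≤⇒≯ Fs≤λ ∘ i+1≤j⇒i<j

  below⁻ : ∀ {λ' s} → Below M F λ' s → F s ≤ λ'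
  below⁻ (_ , ¬λ+1≤Fs) = ℤₚ.≮⇒≥ (¬λ+1≤Fs ∘ i<j⇒i+1≤j)

  lower-neighbour⇒¬minimum : ∀ {y v} → Face M v → Comparable y v → F v ≤ F y → v ≢ y →
                             ¬ Minimum M F (_≡ y)
  lower-neighbour⇒¬minimum {y} {v} fv y~v Fv≤Fy v≢y (λ' , (A⊆below , _ , _ , closed) , _) =
    v≢y (closed y v refl (below⁺ fv (ℤₚ.≤-trans Fv≤Fy (below⁻ {λ'} (A⊆below y refl)))) y~v)

  flatless-facet⇒minimum : ∀ {p y} → Stack M F → Facet M y → HasDim p y →
                           (∀ z → ¬ Grad M F p z y) → Minimum M F (_≡ y)
  flatless-facet⇒minimum {p} {y} stack (fy , y-max) dim-y flatless =
    F y , (component , λ { _ refl (_ , Fy≰Fy) → Fy≰Fy ℤₚ.≤-refl })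
    where
    closed : ∀ a b → a ≡ y → Below M F (F y) b → Comparable a b → b ≡ y
    closed _ b refl (fb , _) (inj₁ y⊆b) = y-max b fb y⊆b
    closed _ b refl b-low (inj₂ b⊆y) with b ⊂? y
    ... | no b⊄y = ⊆∧⊄⇒≡ b⊆y b⊄y
    ... | yes (_ , i , i∈y , i∉b) = contradiction (facet-flat , F-flat) (flatless (y - i))
      where
      fb = proj₁ b-low
      b⊆y-i : b ⊆ y - i
      b⊆y-i j∈b = x∈p∧x≢y⇒x∈p-y (b⊆y j∈b) λ { refl → i∉b j∈b }
      y-i⊆y : y - i ⊆ y
      y-i⊆y = p─q⊆p y ⁅ i ⁆
      f[y-i] : Face M (y - i)
      f[y-i] with Complex.nonempty M b fb
      ... | j , j∈b = Complex.down-closed M y (y - i) fy y-i⊆y (j , b⊆y-i j∈b)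
      facet-flat : CoveringPair M p (y - i) y
      facet-flat = f[y-i] , fy , y-i⊆y , dim-y , ℕₚ.suc-injective (trans (x∈p⇒1+∣p-x∣≡∣p∣ i∈y) dim-y)
      F-flat : F (y - i) ≡ F y
      F-flat = ℤₚ.≤-antisym (ℤₚ.≤-trans (stack b (y - i) fb f[y-i] b⊆y-i) (below⁻ b-low))
                            (stack (y - i) y f[y-i] fy y-i⊆y)
    component : ConnectedComponent (_≡ y) (Below M F (F y))
    component = (λ { _ refl → below⁺ fy ℤₚ.≤-refl })
              , (y , refl)
              , (λ { _ _ refl refl → [ y ] , refl , refl , refl ∷ [] , [-] })
              , closed

module Endpoint {n : ℕ} (M : Complex {n}) (F : Subset n → ℤ) (p : ℕ) where

  open Minima M F

  flat-face-unique : MorseStack M F → ∀ {y z z'} → Grad M F p z y → Grad M F p z' y → z ≡ z'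
  flat-face-unique (_ , morse) {y} {z} {z'} z↘y z'↘y =
    proj₁ (morse y z y z' y (p , z↘y) (p , z'↘y) (inj₂ refl) (inj₂ refl))

  flat-coface-unique : MorseStack M F → ∀ {y u u'} → Grad M F p y u → Grad M F p y u' → u ≡ u'
  flat-coface-unique (_ , morse) {y} {u} {u'} y↗u y↗u' =
    proj₂ (morse y y u y u' (p , y↗u) (p , y↗u') (inj₁ refl) (inj₁ refl))

  grad? : ∀ z y → Dec (Grad M F p z y)
  grad? z y =
    (T? (face M z) ×-dec T? (face M y) ×-dec z ⊆? y ×-dec ∣ y ∣ ℕ.≟ ℕ.suc p ×-dec ∣ z ∣ ℕ.≟ p)
    ×-dec F z ℤₚ.≟ F y

  UniqueStep : Subset n → Set
  UniqueStep y = ∃! _≡_ λ z → Face M z × LambdaStep M F p z y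

  UniqueExtension : List (Subset n) → Set
  UniqueExtension π =
    Σ (Subset n) λ z → Face M z × Extension M F p π z × (∀ w → Face M w → Extension M F p π w → w ≡ z)

  extension⇒step : ∀ {x y z π} → LambdaTildePath M F p x y π → Extension M F p π z →
                   Face M z × LambdaStep M F p z y
  extension⇒step {π = π} (_ , last≡y , _) (_ , _ , _ , faces , steps) =
    All.head (All.++⁻ʳ π faces) , Linked-∷ʳ⁻ π last≡y steps

  step⇒extension : ∀ {x y z π} → LambdaTildePath M F p x y π → Face M z → LambdaStep M F p z y →
                   Extension M F p π z
  step⇒extension {z = z} {π = a ∷ rest} (_ , last≡y , faces , steps) fz step =
    a , refl , last-∷ʳ (a ∷ rest) z , All.++⁺ faces (fz ∷ []) , Linked-∷ʳ⁺ last≡y steps step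

  unique-step⇔unique-extension : ∀ {x y π} → LambdaTildePath M F p x y π →
                                 UniqueStep y ⇔ UniqueExtension π
  unique-step⇔unique-extension path = mk⇔
    (λ { (z , (fz , step) , unique) →
         z , fz , step⇒extension path fz step , λ w fw ext → sym (unique (extension⇒step path ext)) })
    (λ { (z , fz , ext , unique) →
         z , extension⇒step path ext , λ {w} (fw , step) → sym (unique w fw (step⇒extension path fw step)) })

  facet-exactly-one : ∀ {y} → MorseStack M F → Facet M y → HasDim p y →
                      ExactlyOne (Minimum M F (_≡ y)) (UniqueStep y)
  facet-exactly-one {y} morse facet-y dim-y with anySubset? (λ z → grad? z y)
  ... | yes (z , z↘y@((fz , _ , z⊆y , _) , F-flat)) =
    only-right (z , (fz , inj₁ z↘y) , λ {w} → unique {w})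
               (lower-neighbour⇒¬minimum fz (inj₂ z⊆y) (ℤₚ.≤-reflexive F-flat)
                                         λ { refl → lower-face⇒¬HasDim M (proj₁ z↘y) dim-y })
    where
    unique : ∀ {w} → Face M w × LambdaStep M F p w y → z ≡ w
    unique (_ , inj₁ w↘y) = flat-face-unique morse z↘y w↘y
    unique (_ , inj₂ (y↗w , _)) = ⊥-elim (lower-face⇒¬HasDim M y↗w dim-y)
  ... | no ∄flat =
    only-left (flatless-facet⇒minimum (proj₁ morse) facet-y dim-y (λ z z↘y → ∄flat (z , z↘y)))
              λ { (z , (_ , inj₁ z↘y) , _) → ∄flat (z , z↘y)
                ; (_ , (_ , inj₂ (y↗z , _)) , _) → lower-face⇒¬HasDim M y↗z dim-y }

  two-cofaces-exactly-one : ∀ {y u w} → MorseStack M F → Grad M F p y u →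
                            w ≢ u → Face M w → HasDim p w → y ⊆ w →
                            (∀ c → Face M c → HasDim p c → y ⊆ c → c ≡ u ⊎ c ≡ w) →
                            ExactlyOne (Minimum M F (_≡ y)) (UniqueStep y)
  two-cofaces-exactly-one {y} {w = w} morse y↗u@((fy , fu , y⊆u , dim-u , ∣y∣≡p) , F-flat)
                          w≢u fw dim-w y⊆w u-or-w =
    only-right (w , (fw , inj₂ (y↗w , Fw<Fy)) , λ {v} → unique {v})
               (lower-neighbour⇒¬minimum fu (inj₁ y⊆u) (ℤₚ.≤-reflexive (sym F-flat))
                                         λ { refl → lower-face⇒¬HasDim M (proj₁ y↗u) dim-u })
    where
    y↗w : CoveringPair M p y w
    y↗w = fy , fw , y⊆w , dim-w , ∣y∣≡p
    Fw<Fy : F w < F y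
    Fw<Fy = ℤₚ.≤∧≢⇒< (proj₁ morse y w fy fw y⊆w)
                     (λ Fw≡Fy → w≢u (flat-coface-unique morse (y↗w , sym Fw≡Fy) y↗u))
    unique : ∀ {v} → Face M v × LambdaStep M F p v y → w ≡ v
    unique (_ , inj₁ ((_ , _ , _ , dim-y , _) , _)) = ⊥-elim (lower-face⇒¬HasDim M (proj₁ y↗u) dim-y)
    unique (fv , inj₂ ((_ , _ , y⊆v , dim-v , _) , Fv<Fy)) with u-or-w _ fv dim-v y⊆v
    ... | inj₁ refl = ⊥-elim (ℤₚ.<-irrefl (sym F-flat) Fv<Fy)
    ... | inj₂ refl = refl

  ridge-exactly-one : ∀ {y u} → MorseStack M F → NormalPseudomanifold p M → Grad M F p y u →
                      ExactlyOne (Minimum M F (_≡ y)) (UniqueStep y)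
  ridge-exactly-one {y} {u} morse pm y↗u@((fy , fu , y⊆u , dim-u , ∣y∣≡p) , _)
    with NormalPseudomanifold.thin pm y fy ∣y∣≡p
  ... | a , b , a≢b , fa , dim-a , y⊆a , fb , dim-b , y⊆b , a-or-b with a-or-b u fu dim-u y⊆u
  ...   | inj₁ refl = two-cofaces-exactly-one morse y↗u (a≢b ∘ sym) fb dim-b y⊆b a-or-b
  ...   | inj₂ refl = two-cofaces-exactly-one morse y↗u a≢b fa dim-a y⊆a
                          (λ c fc dim-c y⊆c → swap (a-or-b c fc dim-c y⊆c))

  Λ̃-path-end : ∀ {x y π} → (∀ s → Facet M s → HasDim p s) → Facet M x → LambdaTildePath M F p x y π →
               HasDim p y ⊎ ∃ λ u → Grad M F p y u
  Λ̃-path-end {x} pure facet-x (head≡x , last≡y , _ , steps) with Linked-last head≡x last≡y steps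
  ... | inj₁ refl = inj₁ (pure x facet-x)
  ... | inj₂ (u , inj₁ y↗u) = inj₂ (u , y↗u)
  ... | inj₂ (_ , inj₂ ((_ , _ , _ , dim-y , _) , _)) = inj₁ dim-y

proposition3 : {n : ℕ} (d : ℕ) (M : Complex {n}) → NormalPseudomanifold d M →
    (F : Subset n → ℤ) → MorseStack M F →
    (x : Subset n) → Facet M x →
    (y : Subset n) → Face M y →
    (π : List (Subset n)) → LambdaTildePath M F d x y π →
    (Minimum M F (λ s → s ≡ y) ⊎ Σ (Subset n) (λ z → Face M z × Extension M F d π z × (∀ w → Face M w → Extension M F d π w → w ≡ z)))
    × ¬ (Minimum M F (λ s → s ≡ y) × Σ (Subset n) (λ z → Face M z × Extension M F d π z × (∀ w → Face M w → Extension M F d π w → w ≡ z)))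
proposition3 d M pm F morse x facet-x y fy π path =
  ExactlyOne-mapʳ (unique-step⇔unique-extension path) at-endpoint
  where
  open Endpoint M F d
  pure = NormalPseudomanifold.pure pm
  at-endpoint : ExactlyOne (Minimum M F (_≡ y)) (UniqueStep y)
  at-endpoint with Λ̃-path-end pure facet-x path
  ... | inj₁ dim-y = facet-exactly-one morse (pure-face⇒facet M pure y fy dim-y) dim-y
  ... | inj₂ (_ , y↗u) = ridge-exactly-one morse pm y↗u
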